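{- Let $H$ be a graph with binary chromatic number $\chi_B(H)=k+1$ and let $c$ be an integer with $0\le c\le k$ such that $V(H)$ cannot be partitioned into exactly $c$ cliques and $k-c$ cocliques. Let $G$ be a graph on $n$ vertices with density $d=e(G)/\binom{n}{2}$. Unless ($d=0$ and $c=k$) or ($d=1$ and $c=0$), $$\mathrm{Dist}(G,\mathrm{Forb}(n,H))\le \frac{d(1-d)}{dc+(1-d)(k-c)}\binom{n}{2};$$ in the two exceptional cases, $\mathrm{Dist}(G,\mathrm{Forb}(n,H))\le\frac1k\binom{n}{2}$.
   Context: For an $n$-vertex graph $G$, $\mathrm{Dist}(G,\mathrm{Forb}(n,H))$ is the minimum of $|E(G)\,\Delta\,E(G')|$ over all graphs $G'$ on vertex set $V(G)$ containing no induced subgraph isomorphic to $H$ (i.e. the minimum number of edge additions/deletions making $G$ induced-$H$-free). $e(G)$ is the number of edges of $G$. A clique is a vertex set inducing a complete graph, a coclique a vertex set inducing an edgeless graph. The binary chromatic number $\chi_B(H)$ is the least integer $k+1$ such that for every $c\in\{0,\dots,k+1\}$ there is a partition of $V(H)$ into $c$ cliques and $k+1-c$ cocliques (parts may be empty). -}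

module Defs where

open import Data.Nat using (ℕ; zero; suc; _+_; _*_; _∸_; _<_; _≤_; _<ᵇ_)
open import Data.Bool using (Bool; true; false; if_then_else_; _∧_; _xor_)
open import Data.Fin using (Fin; toℕ)
open import Data.List using (List; map; allFin)
open import Data.Nat.ListAction using (sum)
open import Data.Product using (Σ; Σ-syntax; _×_)
open import Function.Definitions using (Injective)
open import Relation.Binary.PropositionalEquality using (_≡_; _≢_)
open import Relation.Nullary using (¬_)

record Graph (n : ℕ) : Set where
  field
    adj   : Fin n → Fin n → Bool
    sym   : ∀ i j → adj i j ≡ adj j i
    irrefl : ∀ i → adj i i ≡ false
open Graph public

countPairs : ∀ {n} → (Fin n → Fin n → Bool) → ℕ
countPairs {n} p =
  sum (map (λ i → sum (map (λ j → if (toℕ i <ᵇ toℕ j) ∧ p i j then 1 else 0)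
                           (allFin n)))
           (allFin n))

edges : ∀ {n} → Graph n → ℕ
edges G = countPairs (adj G)

symDiff : ∀ {n} → Graph n → Graph n → ℕ
symDiff G G' = countPairs (λ i j → adj G i j xor adj G' i j)

HasInduced : ∀ {h n} → Graph h → Graph n → Set
HasInduced {h} {n} H G =
  Σ[ f ∈ (Fin h → Fin n) ] Injective _≡_ _≡_ f ×
    (∀ i j → adj G (f i) (f j) ≡ adj H i j)

InducedFree : ∀ {h n} → Graph h → Graph n → Set
InducedFree H G = ¬ HasInduced H G

-- V(H) can be partitioned into a cliques and b cocliques (parts may be empty):
-- parts are labelled by Fin (a + b); labels < a are cliques, labels ≥ a cocliques.
Partition : ∀ {h} → Graph h → ℕ → ℕ → Set
Partition {h} H a b =
  Σ[ f ∈ (Fin h → Fin (a + b)) ]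
    (∀ i j → i ≢ j → f i ≡ f j →
       (toℕ (f i) < a → adj H i j ≡ true) ×
       (a ≤ toℕ (f i) → adj H i j ≡ false))

AllSplits : ∀ {h} → Graph h → ℕ → Set
AllSplits H m = ∀ c → c ≤ m → Partition H c (m ∸ c)

BinChrom : ∀ {h} → Graph h → ℕ → Set
BinChrom H m = AllSplits H m × (∀ m' → m' < m → ¬ AllSplits H m')

{-# OPTIONS --safe #-}

-- Give every vertex of G one of c + m labels, the first c naming clique classes and the other m
-- coclique classes, and make each clique class complete and each coclique class empty. The
-- result is induced-H-free, since an induced copy of H would inherit a partition into c cliques
-- and m cocliques. The edit cost is the number of non-edges inside clique classes plus the
-- number of edges inside coclique classes. If each vertex independently picks each clique class
-- with weight x and each coclique class with weight y (total D = c x + m y), the expected cost is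
-- (c x² (N − e) + m y² e) / D², where e = e(G) and N = n choose 2. The weights x = e, y = N − e
-- give e (N − e) / D, and x = y = 1 give at most N / (c + m). The method of conditional
-- expectations, run on integers scaled by D², turns the random labelling into an actual one.
module Submission where

open import Data.Bool using (Bool; true; false; not; _∧_; _xor_; if_then_else_)
open import Data.Bool.Properties using (xor-same; xor-comm)
open import Data.Fin using (Fin; zero; suc; toℕ; fromℕ<)
open import Data.Fin.Properties using (_≟_; <⇒≢)
open import Data.List using (map; allFin; tabulate)
open import Data.List.Extrema.Nat using (argmin; f[argmin]≤f[xs])
open import Data.List.Membership.Propositional.Properties using (∈-allFin)
open import Data.List.Properties using (map-tabulate)
open import Data.List.Relation.Unary.All using (lookup)
open import Data.Nat using (ℕ; zero; suc; _+_; _*_; _∸_; _≤_; _<_; _<ᵇ_; _<?_; z≤n; z<s; s<s)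
open import Data.Nat.Combinatorics using (_C_; nC1≡n; nCk+nC[k+1]≡[n+1]C[k+1])
import Data.Nat.ListAction as List
open import Data.Nat.Properties
  using ( +-*-semiring; +-commutativeSemigroup; module ≤-Reasoning
        ; +-assoc; +-identityʳ; *-identityˡ; *-identityʳ; *-zeroʳ; *-comm; *-assoc; *-distribˡ-+; *-distribʳ-+
        ; +-mono-≤; +-monoˡ-≤; +-monoʳ-≤; *-monoʳ-≤; *-cancelʳ-≤
        ; m≤m+n; m∸n≤m; m+n∸m≡n; m+[n∸m]≡n; ≤⇒≯ )
open import Data.Nat.Tactic.RingSolver using (solve-∀)
open import Data.Product using (Σ; Σ-syntax; ∃-syntax; _×_; _,_; proj₁; proj₂; map₂)
open import Data.Sum using (_⊎_)
open import Data.Vec.Functional using (_∷_)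
open import Defs hiding (sym)
open import Function using (_∘_)
open import Relation.Binary.PropositionalEquality
  using (_≡_; _≢_; refl; sym; trans; cong; cong₂; subst; subst₂; module ≡-Reasoning)
open import Relation.Nullary using (¬_; does; yes; no; contradiction)
open import Relation.Nullary.Decidable using (dec-true; dec-false)

open import Algebra.Properties.Semiring.Sum +-*-semiring
  using (sum; sum-syntax; sum-cong-≗; sum-replicate-zero; ∑-distrib-+; *-distribˡ-sum; *-distribʳ-sum)
open import Algebra.Properties.CommutativeSemigroup +-commutativeSemigroup using (interchange)

∑-zero : ∀ {n} {f : Fin n → ℕ} → (∀ i → f i ≡ 0) → sum f ≡ 0
∑-zero {n} f≡0 = trans (sum-cong-≗ f≡0) (sum-replicate-zero n)

∑-const : ∀ n x → ∑[ i < n ] x ≡ n * x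
∑-const zero    x = refl
∑-const (suc n) x = cong (x +_) (∑-const n x)

∑-mono-≤ : ∀ {n} {f g : Fin n → ℕ} → (∀ i → f i ≤ g i) → sum f ≤ sum g
∑-mono-≤ {zero}  f≤g = z≤n
∑-mono-≤ {suc n} f≤g = +-mono-≤ (f≤g zero) (∑-mono-≤ (f≤g ∘ suc))

iverson : Bool → ℕ
iverson b = if b then 1 else 0

iverson-complement : ∀ b → iverson b + iverson (not b) ≡ 1
iverson-complement true  = refl
iverson-complement false = refl

onlyAt : ∀ {K} → Fin K → ℕ → Fin K → ℕ
onlyAt i x j = if does (i ≟ j) then x else 0

∑-weighted-onlyAt : ∀ {K} (w : Fin K → ℕ) i x → ∑[ j < K ] (w j * onlyAt i x j) ≡ w i * x
∑-weighted-onlyAt w zero    x =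
  trans (cong (w zero * x +_) (∑-zero (λ j → *-zeroʳ (w (suc j))))) (+-identityʳ (w zero * x))
∑-weighted-onlyAt {suc K} w (suc i) x =
  trans (cong (_+ ∑[ j < K ] (w (suc j) * onlyAt i x j)) (*-zeroʳ (w zero))) (∑-weighted-onlyAt (w ∘ suc) i x)

-- For n = suc n′ this unfolds definitionally into the pairs {0, suc v} plus pairSum over the
-- pairs {suc u, suc v}; the inductive proofs below rely on that.
pairSum : ∀ {n} → (Fin n → Fin n → ℕ) → ℕ
pairSum {n} h = ∑[ u < n ] ∑[ v < n ] (if toℕ u <ᵇ toℕ v then h u v else 0)

pairSum-cong : ∀ {n} {h h' : Fin n → Fin n → ℕ} →
               (∀ u v → toℕ u < toℕ v → h u v ≡ h' u v) → pairSum h ≡ pairSum h'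
pairSum-cong {zero}  h≡h' = refl
pairSum-cong {suc n} h≡h' = cong₂ _+_ (sum-cong-≗ (λ v → h≡h' zero (suc v) z<s))
                                      (pairSum-cong (λ u v u<v → h≡h' (suc u) (suc v) (s<s u<v)))

pairSum-distrib-+ : ∀ {n} (h h' : Fin n → Fin n → ℕ) →
                    pairSum (λ u v → h u v + h' u v) ≡ pairSum h + pairSum h'
pairSum-distrib-+ {zero}  h h' = refl
pairSum-distrib-+ {suc n} h h' =
  trans (cong₂ _+_ (∑-distrib-+ (h zero ∘ suc) (h' zero ∘ suc))
                   (pairSum-distrib-+ (λ u v → h (suc u) (suc v)) (λ u v → h' (suc u) (suc v))))
        (interchange (∑[ v < n ] h zero (suc v)) (∑[ v < n ] h' zero (suc v))
                     (pairSum (λ u v → h (suc u) (suc v))) (pairSum (λ u v → h' (suc u) (suc v))))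

pairSum-1≡C2 : ∀ n → pairSum {n} (λ _ _ → 1) ≡ n C 2
pairSum-1≡C2 zero    = refl
pairSum-1≡C2 (suc n) = begin
  ∑[ v < n ] 1 + pairSum {n} (λ _ _ → 1)  ≡⟨ cong₂ _+_ (trans (∑-const n 1) (*-identityʳ n))
                                                       (pairSum-1≡C2 n) ⟩
  n + n C 2                               ≡⟨ cong (_+ n C 2) (nC1≡n n) ⟨
  n C 1 + n C 2                           ≡⟨ nCk+nC[k+1]≡[n+1]C[k+1] n 1 ⟩
  suc n C 2                               ∎
  where open ≡-Reasoning

pairSum-iverson-complement : ∀ {n} (p : Fin n → Fin n → Bool) →
  pairSum (λ u v → iverson (p u v)) + pairSum (λ u v → iverson (not (p u v))) ≡ n C 2
pairSum-iverson-complement {n} p = begin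
  pairSum (λ u v → iverson (p u v)) + pairSum (λ u v → iverson (not (p u v)))
    ≡⟨ pairSum-distrib-+ (λ u v → iverson (p u v)) (λ u v → iverson (not (p u v))) ⟨
  pairSum (λ u v → iverson (p u v) + iverson (not (p u v)))
    ≡⟨ pairSum-cong (λ u v _ → iverson-complement (p u v)) ⟩
  pairSum {n} (λ _ _ → 1)
    ≡⟨ pairSum-1≡C2 n ⟩
  n C 2 ∎
  where open ≡-Reasoning

sum-tabulate : ∀ {n} (f : Fin n → ℕ) → List.sum (tabulate f) ≡ sum f
sum-tabulate {zero}  f = refl
sum-tabulate {suc n} f = cong (f zero +_) (sum-tabulate (f ∘ suc))

sum-map-allFin : ∀ {n} (f : Fin n → ℕ) → List.sum (map f (allFin n)) ≡ sum f
sum-map-allFin f = trans (cong List.sum (map-tabulate (λ i → i) f)) (sum-tabulate f)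

countPairs≡pairSum : ∀ {n} (p : Fin n → Fin n → Bool) → countPairs p ≡ pairSum (λ u v → iverson (p u v))
countPairs≡pairSum {n} p = begin
  countPairs p
    ≡⟨ sum-map-allFin (λ u → List.sum (map (entry u) (allFin n))) ⟩
  ∑[ u < n ] List.sum (map (entry u) (allFin n))
    ≡⟨ sum-cong-≗ (λ u → sum-map-allFin (entry u)) ⟩
  ∑[ u < n ] ∑[ v < n ] entry u v
    ≡⟨ sum-cong-≗ (λ u → sum-cong-≗ (λ v → masked (toℕ u <ᵇ toℕ v) (p u v))) ⟩
  pairSum (λ u v → iverson (p u v)) ∎
  where
  open ≡-Reasoning
  entry : Fin n → Fin n → ℕ
  entry u v = if (toℕ u <ᵇ toℕ v) ∧ p u v then 1 else 0
  masked : ∀ b x → (if b ∧ x then 1 else 0) ≡ (if b then iverson x else 0)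
  masked true  x = refl
  masked false x = refl

∑w*x[argmin]≤∑w*x : ∀ {K} (i₀ : Fin K) (w x : Fin K → ℕ) →
                    sum w * x (argmin x i₀ (allFin K)) ≤ ∑[ j < K ] (w j * x j)
∑w*x[argmin]≤∑w*x {K} i₀ w x = begin
  sum w * x i             ≡⟨ *-distribʳ-sum (x i) w ⟩
  ∑[ j < K ] (w j * x i)  ≤⟨ ∑-mono-≤ (λ j → *-monoʳ-≤ (w j) (minimal j)) ⟩
  ∑[ j < K ] (w j * x j)  ∎
  where
  open ≤-Reasoning
  i : Fin K
  i = argmin x i₀ (allFin K)
  minimal : ∀ j → x i ≤ x j
  minimal j = lookup (f[argmin]≤f[xs] i₀ (allFin K)) (∈-allFin j)

collisionCost : ∀ {K n} → (Fin K → Fin n → Fin n → ℕ) → (Fin n → Fin K) → ℕ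
collisionCost β f = pairSum (λ u v → onlyAt (f u) (β (f u) u v) (f v))

cost : ∀ {K n} → (Fin K → Fin n → Fin n → ℕ) → (Fin n → Fin K → ℕ) → (Fin n → Fin K) → ℕ
cost {n = n} β ℓ f = collisionCost β f + ∑[ v < n ] ℓ v (f v)

module WeightedColouring {K : ℕ} (w : Fin K → ℕ) where

  D : ℕ
  D = sum w

  -- expectedCollisions β + D * expectedVertexCost ℓ is D² times the expected cost of the
  -- random colouring that gives each vertex colour i independently with probability w i / D.
  expectedCollisions : ∀ {n} → (Fin K → Fin n → Fin n → ℕ) → ℕ
  expectedCollisions β = ∑[ i < K ] (w i * w i * pairSum (β i))

  expectedVertexCost : ∀ {n} → (Fin n → Fin K → ℕ) → ℕ
  expectedVertexCost {n} ℓ = ∑[ v < n ] ∑[ i < K ] (w i * ℓ v i)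

  expectedCost : ∀ {n} → (Fin K → Fin n → Fin n → ℕ) → (Fin n → Fin K → ℕ) → ℕ
  expectedCost β ℓ = expectedCollisions β + D * expectedVertexCost ℓ

  module FirstVertex {n} (β : Fin K → Fin (suc n) → Fin (suc n) → ℕ) (ℓ : Fin (suc n) → Fin K → ℕ) where

    β⁺ : Fin K → Fin n → Fin n → ℕ
    β⁺ i u v = β i (suc u) (suc v)

    ℓ⁺ : Fin n → Fin K → ℕ
    ℓ⁺ v = ℓ (suc v)

    rowCost : Fin K → ℕ
    rowCost i = ∑[ v < n ] β i zero (suc v)

    ℓ[_] : Fin K → Fin n → Fin K → ℕ
    ℓ[ i ] v j = ℓ⁺ v j + onlyAt i (β i zero (suc v)) j

    firstVertexCost : Fin K → ℕ
    firstVertexCost i = w i * rowCost i + D * ℓ zero i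

    cost-∷ : ∀ i f → cost β ℓ (i ∷ f) ≡ cost β⁺ ℓ[ i ] f + ℓ zero i
    cost-∷ i f = begin
      (R + P) + (ℓ zero i + S)
        ≡⟨ rearrange R P (ℓ zero i) S ⟩
      (P + (S + R)) + ℓ zero i
        ≡⟨ cong (λ t → P + t + ℓ zero i) (∑-distrib-+ (λ v → ℓ⁺ v (f v)) onlyAtRow) ⟨
      (P + ∑[ v < n ] ℓ[ i ] v (f v)) + ℓ zero i ∎
      where
      open ≡-Reasoning
      onlyAtRow : Fin n → ℕ
      onlyAtRow v = onlyAt i (β i zero (suc v)) (f v)
      R P S : ℕ
      R = sum onlyAtRow
      P = collisionCost β⁺ f
      S = ∑[ v < n ] ℓ⁺ v (f v)
      rearrange : ∀ R P l S → (R + P) + (l + S) ≡ (P + (S + R)) + l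
      rearrange = solve-∀

    expectedVertexCost-ℓ[] : ∀ i → expectedVertexCost ℓ[ i ] ≡ expectedVertexCost ℓ⁺ + w i * rowCost i
    expectedVertexCost-ℓ[] i = begin
      ∑[ v < n ] ∑[ j < K ] (w j * ℓ[ i ] v j)
        ≡⟨ sum-cong-≗ (λ v → sum-cong-≗ (λ j →
             *-distribˡ-+ (w j) (ℓ⁺ v j) (onlyAt i (β i zero (suc v)) j))) ⟩
      ∑[ v < n ] ∑[ j < K ] (w j * ℓ⁺ v j + w j * onlyAt i (β i zero (suc v)) j)
        ≡⟨ sum-cong-≗ (λ v → trans
             (∑-distrib-+ (λ j → w j * ℓ⁺ v j) (λ j → w j * onlyAt i (β i zero (suc v)) j))
             (cong (∑[ j < K ] (w j * ℓ⁺ v j) +_) (∑-weighted-onlyAt w i (β i zero (suc v))))) ⟩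
      ∑[ v < n ] (∑[ j < K ] (w j * ℓ⁺ v j) + w i * β i zero (suc v))
        ≡⟨ ∑-distrib-+ (λ v → ∑[ j < K ] (w j * ℓ⁺ v j)) (λ v → w i * β i zero (suc v)) ⟩
      expectedVertexCost ℓ⁺ + ∑[ v < n ] (w i * β i zero (suc v))
        ≡⟨ cong (expectedVertexCost ℓ⁺ +_) (*-distribˡ-sum (w i) (λ v → β i zero (suc v))) ⟨
      expectedVertexCost ℓ⁺ + w i * rowCost i ∎
      where open ≡-Reasoning

    expectedCost-ℓ[] : ∀ i → expectedCost β⁺ ℓ[ i ] + ℓ zero i * (D * D)
                             ≡ expectedCost β⁺ ℓ⁺ + D * firstVertexCost i
    expectedCost-ℓ[] i = begin
      Q + D * expectedVertexCost ℓ[ i ] + ℓ zero i * (D * D)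
        ≡⟨ cong (λ t → Q + D * t + ℓ zero i * (D * D)) (expectedVertexCost-ℓ[] i) ⟩
      Q + D * (L + w i * rowCost i) + ℓ zero i * (D * D)
        ≡⟨ rearrange Q D L (w i * rowCost i) (ℓ zero i) ⟩
      Q + D * L + D * (w i * rowCost i + D * ℓ zero i) ∎
      where
      open ≡-Reasoning
      Q L : ℕ
      Q = expectedCollisions β⁺
      L = expectedVertexCost ℓ⁺
      rearrange : ∀ Q D L a l → Q + D * (L + a) + l * (D * D) ≡ Q + D * L + D * (a + D * l)
      rearrange = solve-∀

    ∑-weighted-firstVertexCost : ∑[ i < K ] (w i * firstVertexCost i)
                                 ≡ ∑[ i < K ] (w i * w i * rowCost i) + D * ∑[ i < K ] (w i * ℓ zero i)
    ∑-weighted-firstVertexCost = begin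
      ∑[ i < K ] (w i * firstVertexCost i)
        ≡⟨ sum-cong-≗ (λ i → distrib (w i) (rowCost i) D (ℓ zero i)) ⟩
      ∑[ i < K ] (w i * w i * rowCost i + D * (w i * ℓ zero i))
        ≡⟨ ∑-distrib-+ (λ i → w i * w i * rowCost i) (λ i → D * (w i * ℓ zero i)) ⟩
      ∑[ i < K ] (w i * w i * rowCost i) + ∑[ i < K ] (D * (w i * ℓ zero i))
        ≡⟨ cong (∑[ i < K ] (w i * w i * rowCost i) +_) (*-distribˡ-sum D (λ i → w i * ℓ zero i)) ⟨
      ∑[ i < K ] (w i * w i * rowCost i) + D * ∑[ i < K ] (w i * ℓ zero i) ∎
      where
      open ≡-Reasoning
      distrib : ∀ w r D l → w * (w * r + D * l) ≡ w * w * r + D * (w * l)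
      distrib = solve-∀

    expectedCost-split : expectedCost β ℓ ≡ expectedCost β⁺ ℓ⁺ + ∑[ i < K ] (w i * firstVertexCost i)
    expectedCost-split = begin
      ∑[ i < K ] (w i * w i * (rowCost i + pairSum (β⁺ i))) + D * (L₀ + L)
        ≡⟨ cong (_+ D * (L₀ + L)) (trans
             (sum-cong-≗ (λ i → *-distribˡ-+ (w i * w i) (rowCost i) (pairSum (β⁺ i))))
             (∑-distrib-+ (λ i → w i * w i * rowCost i) (λ i → w i * w i * pairSum (β⁺ i)))) ⟩
      (A + Q) + D * (L₀ + L)
        ≡⟨ rearrange A Q D L₀ L ⟩
      (Q + D * L) + (A + D * L₀)
        ≡⟨ cong (Q + D * L +_) ∑-weighted-firstVertexCost ⟨
      (Q + D * L) + ∑[ i < K ] (w i * firstVertexCost i) ∎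
      where
      open ≡-Reasoning
      A Q L₀ L : ℕ
      A = ∑[ i < K ] (w i * w i * rowCost i)
      Q = expectedCollisions β⁺
      L₀ = ∑[ i < K ] (w i * ℓ zero i)
      L = expectedVertexCost ℓ⁺
      rearrange : ∀ A Q D L₀ L → (A + Q) + D * (L₀ + L) ≡ (Q + D * L) + (A + D * L₀)
      rearrange = solve-∀

  -- Method of conditional expectations: vertex 0 takes a colour minimising the conditional
  -- expectation, and its collisions with the later vertices become vertex costs of those.
  ∃cost≤expectedCost : Fin K → ∀ {n} (β : Fin K → Fin n → Fin n → ℕ) (ℓ : Fin n → Fin K → ℕ) →
                       ∃[ f ] cost β ℓ f * (D * D) ≤ expectedCost β ℓ
  ∃cost≤expectedCost i₀ {zero}  β ℓ = (λ ()) , z≤n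
  ∃cost≤expectedCost i₀ {suc n} β ℓ = i ∷ f , bound
    where
    open FirstVertex β ℓ
    i : Fin K
    i = argmin firstVertexCost i₀ (allFin K)
    f : Fin n → Fin K
    f = proj₁ (∃cost≤expectedCost i₀ β⁺ ℓ[ i ])
    bound : cost β ℓ (i ∷ f) * (D * D) ≤ expectedCost β ℓ
    bound = begin
      cost β ℓ (i ∷ f) * (D * D)
        ≡⟨ cong (_* (D * D)) (cost-∷ i f) ⟩
      (cost β⁺ ℓ[ i ] f + ℓ zero i) * (D * D)
        ≡⟨ *-distribʳ-+ (D * D) (cost β⁺ ℓ[ i ] f) (ℓ zero i) ⟩
      cost β⁺ ℓ[ i ] f * (D * D) + ℓ zero i * (D * D)
        ≤⟨ +-monoˡ-≤ _ (proj₂ (∃cost≤expectedCost i₀ β⁺ ℓ[ i ])) ⟩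
      expectedCost β⁺ ℓ[ i ] + ℓ zero i * (D * D)
        ≡⟨ expectedCost-ℓ[] i ⟩
      expectedCost β⁺ ℓ⁺ + D * firstVertexCost i
        ≤⟨ +-monoʳ-≤ _ (∑w*x[argmin]≤∑w*x i₀ w firstVertexCost) ⟩
      expectedCost β⁺ ℓ⁺ + ∑[ j < K ] (w j * firstVertexCost j)
        ≡⟨ expectedCost-split ⟨
      expectedCost β ℓ ∎
      where open ≤-Reasoning

  ∃collisionCost≤expectedCollisions : Fin K → ∀ {n} (β : Fin K → Fin n → Fin n → ℕ) →
                                      ∃[ f ] collisionCost β f * (D * D) ≤ expectedCollisions β
  ∃collisionCost≤expectedCollisions i₀ {n} β = f , subst₂ _≤_ noCost noExpectedCost bound
    where
    f : Fin n → Fin K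
    f = proj₁ (∃cost≤expectedCost i₀ β (λ _ _ → 0))
    bound : cost β (λ _ _ → 0) f * (D * D) ≤ expectedCost β (λ _ _ → 0)
    bound = proj₂ (∃cost≤expectedCost i₀ β (λ _ _ → 0))
    noCost : cost β (λ _ _ → 0) f * (D * D) ≡ collisionCost β f * (D * D)
    noCost = cong (_* (D * D)) (trans (cong (collisionCost β f +_) (sum-replicate-zero n))
                                      (+-identityʳ (collisionCost β f)))
    noExpectedCost : expectedCost β (λ _ _ → 0) ≡ expectedCollisions β
    noExpectedCost = begin
      expectedCollisions β + D * expectedVertexCost {n} (λ _ _ → 0)
        ≡⟨ cong (λ t → expectedCollisions β + D * t) (∑-zero {n} (λ v → ∑-zero (λ i → *-zeroʳ (w i)))) ⟩
      expectedCollisions β + D * 0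
        ≡⟨ cong (expectedCollisions β +_) (*-zeroʳ D) ⟩
      expectedCollisions β + 0
        ≡⟨ +-identityʳ (expectedCollisions β) ⟩
      expectedCollisions β ∎
      where open ≡-Reasoning

isCliqueClass : ∀ {K} → ℕ → Fin K → Bool
isCliqueClass c i = does (toℕ i <? c)

byClass : ∀ {K} → ℕ → ℕ → ℕ → Fin K → ℕ
byClass c x y i = if isCliqueClass c i then x else y

∑-byClass : ∀ c m x y → ∑[ i < c + m ] byClass c x y i ≡ c * x + m * y
∑-byClass zero    m x y = ∑-const m y
∑-byClass (suc c) m x y = trans (cong (x +_) (∑-byClass c m x y)) (sym (+-assoc x (c * x) (m * y)))

misfit : ∀ {n K} → Graph n → ℕ → Fin K → Fin n → Fin n → ℕ
misfit G c i u v = iverson (isCliqueClass c i xor adj G u v)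

nonEdges : ∀ {n} → Graph n → ℕ
nonEdges G = pairSum (λ u v → iverson (not (adj G u v)))

edges+nonEdges : ∀ {n} (G : Graph n) → edges G + nonEdges G ≡ n C 2
edges+nonEdges G = trans (cong (_+ nonEdges G) (countPairs≡pairSum (adj G))) (pairSum-iverson-complement (adj G))

pairSum-misfit : ∀ {n K} (G : Graph n) c (i : Fin K) →
                 pairSum (misfit G c i) ≡ byClass c (n C 2 ∸ edges G) (edges G) i
pairSum-misfit {n} G c i with isCliqueClass c i
... | true  = trans (sym (m+n∸m≡n (edges G) (nonEdges G))) (cong (_∸ edges G) (edges+nonEdges G))
... | false = sym (countPairs≡pairSum (adj G))

module Clustering {n K} (G : Graph n) (c : ℕ) (f : Fin n → Fin K) where

  clusterAdj : Fin n → Fin n → Bool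
  clusterAdj u v = if does (u ≟ v) then false
                   else if does (f u ≟ f v) then isCliqueClass c (f u)
                   else adj G u v

  clusterAdj-sym : ∀ u v → clusterAdj u v ≡ clusterAdj v u
  clusterAdj-sym u v with u ≟ v | v ≟ u
  ... | yes _   | yes _   = refl
  ... | yes u≡v | no  v≢u = contradiction (sym u≡v) v≢u
  ... | no  u≢v | yes v≡u = contradiction (sym v≡u) u≢v
  ... | no  _   | no  _ with f u ≟ f v | f v ≟ f u
  ...   | yes fu≡fv | yes _     = cong (isCliqueClass c) fu≡fv
  ...   | yes fu≡fv | no  fv≢fu = contradiction (sym fu≡fv) fv≢fu
  ...   | no  fu≢fv | yes fv≡fu = contradiction (sym fv≡fu) fu≢fv
  ...   | no  _     | no  _     = Graph.sym G u v

  clusterAdj-irrefl : ∀ u → clusterAdj u u ≡ false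
  clusterAdj-irrefl u rewrite dec-true (u ≟ u) refl = refl

  cluster : Graph n
  cluster = record { adj = clusterAdj ; sym = clusterAdj-sym ; irrefl = clusterAdj-irrefl }

  clusterAdj-sameClass : ∀ {u v} → u ≢ v → f u ≡ f v → clusterAdj u v ≡ isCliqueClass c (f u)
  clusterAdj-sameClass {u} {v} u≢v fu≡fv rewrite dec-false (u ≟ v) u≢v | dec-true (f u ≟ f v) fu≡fv = refl

  symDiff-cluster : symDiff G cluster ≡ collisionCost (misfit G c) f
  symDiff-cluster = trans (countPairs≡pairSum (λ u v → adj G u v xor clusterAdj u v)) (pairSum-cong agree)
    where
    agree : ∀ u v → toℕ u < toℕ v →
            iverson (adj G u v xor clusterAdj u v) ≡ onlyAt (f u) (misfit G c (f u) u v) (f v)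
    agree u v u<v rewrite dec-false (u ≟ v) (<⇒≢ u<v) with f u ≟ f v
    ... | yes _ = cong iverson (xor-comm (adj G u v) (isCliqueClass c (f u)))
    ... | no  _ = cong iverson (xor-same (adj G u v))

cluster-inducedFree : ∀ {h n} {H : Graph h} (G : Graph n) {c m} (f : Fin n → Fin (c + m)) →
                      ¬ Partition H c m → InducedFree H (Clustering.cluster G c f)
cluster-inducedFree {H = H} G {c} f ¬partition (g , g-injective , g-adj) = ¬partition (f ∘ g , classes)
  where
  open Clustering G c f
  classes : ∀ a b → a ≢ b → f (g a) ≡ f (g b) →
            (toℕ (f (g a)) < c → adj H a b ≡ true) × (c ≤ toℕ (f (g a)) → adj H a b ≡ false)
  classes a b a≢b same = (λ lt → trans adjH (dec-true (toℕ (f (g a)) <? c) lt))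
                       , (λ ge → trans adjH (dec-false (toℕ (f (g a)) <? c) (≤⇒≯ ge)))
    where
    adjH : adj H a b ≡ isCliqueClass c (f (g a))
    adjH = trans (sym (g-adj a b)) (clusterAdj-sameClass (a≢b ∘ g-injective) same)

∃inducedFree-symDiff*total²≤ :
  ∀ {h n} (H : Graph h) c m → ¬ Partition H c m → Fin (c + m) → (G : Graph n) (x y : ℕ) →
  Σ[ G' ∈ Graph n ] InducedFree H G' ×
    symDiff G G' * ((c * x + m * y) * (c * x + m * y)) ≤ c * (x * x * (n C 2 ∸ edges G)) + m * (y * y * edges G)
∃inducedFree-symDiff*total²≤ {n = n} H c m ¬partition i₀ G x y =
  cluster , cluster-inducedFree {H = H} G f ¬partition , bound
  where
  open WeightedColouring (byClass c x y)
  f : Fin n → Fin (c + m)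
  f = proj₁ (∃collisionCost≤expectedCollisions i₀ (misfit G c))
  open Clustering G c f
  M : ℕ
  M = n C 2 ∸ edges G
  square : ∀ b → (if b then x else y) * (if b then x else y) * (if b then M else edges G)
                 ≡ (if b then x * x * M else y * y * edges G)
  square true  = refl
  square false = refl
  expectedMisfits : expectedCollisions (misfit G c) ≡ c * (x * x * M) + m * (y * y * edges G)
  expectedMisfits = begin
    ∑[ i < c + m ] (byClass c x y i * byClass c x y i * pairSum (misfit G c i))
      ≡⟨ sum-cong-≗ {c + m} (λ i → trans (cong (byClass c x y i * byClass c x y i *_) (pairSum-misfit G c i))
                                         (square (isCliqueClass c i))) ⟩
    ∑[ i < c + m ] byClass c (x * x * M) (y * y * edges G) i
      ≡⟨ ∑-byClass c m (x * x * M) (y * y * edges G) ⟩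
    c * (x * x * M) + m * (y * y * edges G) ∎
    where open ≡-Reasoning
  bound : symDiff G cluster * ((c * x + m * y) * (c * x + m * y)) ≤ c * (x * x * M) + m * (y * y * edges G)
  bound = begin
    symDiff G cluster * ((c * x + m * y) * (c * x + m * y))
      ≡⟨ cong₂ (λ s d → s * (d * d)) symDiff-cluster (sym (∑-byClass c m x y)) ⟩
    collisionCost (misfit G c) f * (D * D)
      ≤⟨ proj₂ (∃collisionCost≤expectedCollisions i₀ (misfit G c)) ⟩
    expectedCollisions (misfit G c)
      ≡⟨ expectedMisfits ⟩
    c * (x * x * M) + m * (y * y * edges G) ∎
    where open ≤-Reasoning

m*[n*n]≤o*n⇒m*n≤o : ∀ m n o → m * (n * n) ≤ o * n → m * n ≤ o
m*[n*n]≤o*n⇒m*n≤o m zero       o _  = subst (_≤ o) (sym (*-zeroʳ m)) z≤n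
m*[n*n]≤o*n⇒m*n≤o m n@(suc _) o le = *-cancelʳ-≤ (m * n) o n (subst (_≤ o * n) (sym (*-assoc m n n)) le)

∃inducedFree-symDiff*total≤ :
  ∀ {h n} (H : Graph h) c m → ¬ Partition H c m → Fin (c + m) → (G : Graph n) →
  Σ[ G' ∈ Graph n ] InducedFree H G' ×
    symDiff G G' * (edges G * c + (n C 2 ∸ edges G) * m) ≤ edges G * (n C 2 ∸ edges G)
∃inducedFree-symDiff*total≤ {n = n} H c m ¬partition i₀ G =
  map₂ (λ {G'} → map₂ (cancel (symDiff G G'))) (∃inducedFree-symDiff*total²≤ H c m ¬partition i₀ G e M)
  where
  e M : ℕ
  e = edges G
  M = n C 2 ∸ edges G
  cancel : ∀ s → s * ((c * e + m * M) * (c * e + m * M)) ≤ c * (e * e * M) + m * (M * M * e) →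
           s * (e * c + M * m) ≤ e * M
  cancel s le = m*[n*n]≤o*n⇒m*n≤o s (e * c + M * m) (e * M)
                  (subst₂ (λ d r → s * (d * d) ≤ r) (total c e m M) (expected c e m M) le)
    where
    total : ∀ c e m M → c * e + m * M ≡ e * c + M * m
    total = solve-∀
    expected : ∀ c e m M → c * (e * e * M) + m * (M * M * e) ≡ e * M * (e * c + M * m)
    expected = solve-∀

∃inducedFree-symDiff*classes≤ :
  ∀ {h n} (H : Graph h) c m → ¬ Partition H c m → Fin (c + m) → (G : Graph n) →
  Σ[ G' ∈ Graph n ] InducedFree H G' × symDiff G G' * (c + m) ≤ n C 2
∃inducedFree-symDiff*classes≤ {n = n} H c m ¬partition i₀ G =
  map₂ (λ {G'} → map₂ (cancel (symDiff G G'))) (∃inducedFree-symDiff*total²≤ H c m ¬partition i₀ G 1 1)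
  where
  e N : ℕ
  e = edges G
  N = n C 2
  e≤N : e ≤ N
  e≤N = subst (e ≤_) (edges+nonEdges G) (m≤m+n e (nonEdges G))
  cancel : ∀ s → s * ((c * 1 + m * 1) * (c * 1 + m * 1)) ≤ c * (1 * 1 * (N ∸ e)) + m * (1 * 1 * e) →
           s * (c + m) ≤ N
  cancel s le = m*[n*n]≤o*n⇒m*n≤o s (c + m) N (begin
    s * ((c + m) * (c + m))
      ≡⟨ cong (λ d → s * (d * d)) (cong₂ _+_ (*-identityʳ c) (*-identityʳ m)) ⟨
    s * ((c * 1 + m * 1) * (c * 1 + m * 1))
      ≤⟨ le ⟩
    c * (1 * 1 * (N ∸ e)) + m * (1 * 1 * e)
      ≡⟨ cong₂ (λ a b → c * a + m * b) (*-identityˡ (N ∸ e)) (*-identityˡ e) ⟩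
    c * (N ∸ e) + m * e
      ≤⟨ +-mono-≤ (*-monoʳ-≤ c (m∸n≤m N e)) (*-monoʳ-≤ m e≤N) ⟩
    c * N + m * N
      ≡⟨ *-distribʳ-+ N c m ⟨
    (c + m) * N
      ≡⟨ *-comm (c + m) N ⟩
    N * (c + m) ∎)
    where open ≤-Reasoning

-- The hypotheses χ_B(H) = k + 1 and n ≥ 2 are not needed, nor is the case distinction: both
-- bounds hold for every G, the first trivially when its weight e c + (N − e)(k − c) vanishes.
lemma3p1 : ∀ {h n} (H : Graph h) (k c : ℕ) → 1 ≤ k → BinChrom H (suc k) →
    c ≤ k → ¬ Partition H c (k ∸ c) → 2 ≤ n → (G : Graph n) →
    (¬ ((edges G ≡ 0 × c ≡ k) ⊎ (edges G ≡ n C 2 × c ≡ 0)) →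
      Σ[ G' ∈ Graph n ] InducedFree H G' ×
        symDiff G G' * (edges G * c + (n C 2 ∸ edges G) * (k ∸ c))
          ≤ edges G * (n C 2 ∸ edges G))
    ×
    ((edges G ≡ 0 × c ≡ k) ⊎ (edges G ≡ n C 2 × c ≡ 0) →
      Σ[ G' ∈ Graph n ] InducedFree H G' × symDiff G G' * k ≤ n C 2)
lemma3p1 H k c 1≤k _ c≤k ¬partition _ G =
    (λ _ → ∃inducedFree-symDiff*total≤ H c (k ∸ c) ¬partition i₀ G)
  , (λ _ → subst (λ K → Σ[ G' ∈ _ ] InducedFree H G' × symDiff G G' * K ≤ _) c+m≡k
                 (∃inducedFree-symDiff*classes≤ H c (k ∸ c) ¬partition i₀ G))
  where
  c+m≡k : c + (k ∸ c) ≡ k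
  c+m≡k = m+[n∸m]≡n c≤k
  i₀ : Fin (c + (k ∸ c))
  i₀ = subst Fin (sym c+m≡k) (fromℕ< 1≤k)
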